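{- Let $\Lambda$ be a numerical semigroup with enumeration $\lambda$, genus $g$ and conductor $c$. For $i\in\mathbb{N}_0$ let $D(i)=\{l\in\mathbb{N}_0 : l\notin\Lambda \text{ and } \lambda_i-l\notin\Lambda\}$. Then an element $\lambda_i\geq c$ is a generator of $\Lambda$ if and only if $\#D(i)=g-i+1$.
   Context: A numerical semigroup is a subset $\Lambda\subseteq\mathbb{N}_0$ that contains $0$, is closed under addition, and has finite complement in $\mathbb{N}_0$. The elements of $\mathbb{N}_0\setminus\Lambda$ are the gaps; their number is the genus $g$. The conductor $c$ is the smallest integer such that every integer $\geq c$ lies in $\Lambda$. The enumeration of $\Lambda$ is the unique increasing bijection $\lambda:\mathbb{N}_0\to\Lambda$, written $i\mapsto\lambda_i$. The generators of $\Lambda$ are the elements of its (unique) minimal generating set, i.e. the nonzero elements of $\Lambda$ that are not a sum of two nonzero elements of $\Lambda$. -}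

module Defs where

open import Data.Nat using (ℕ; zero; suc; _+_; _∸_; _≤_; _<_; _≤?_)
open import Data.Product using (Σ; ∃; _×_; _,_)
open import Data.Empty using (⊥)
open import Relation.Nullary using (¬_; Dec; yes; no)
open import Relation.Nullary.Decidable using (_×-dec_; ¬?)
open import Relation.Binary.PropositionalEquality using (_≡_; _≢_)
open import Relation.Unary using (Pred; Decidable)
open import Level using (0ℓ)

record NumericalSemigroup : Set₁ where
  field
    _∈Λ      : Pred ℕ 0ℓ
    _∈Λ?     : Decidable _∈Λ
    zero∈    : 0 ∈Λ
    closed   : ∀ {a b} → a ∈Λ → b ∈Λ → (a + b) ∈Λ
    cofinite : ∃ λ N → ∀ n → N ≤ n → n ∈Λ
open NumericalSemigroup public

count : {P : Pred ℕ 0ℓ} → Decidable P → ℕ → ℕ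
count P? zero = 0
count P? (suc N) with P? N
... | yes _ = suc (count P? N)
... | no  _ = count P? N

HasSize : {P : Pred ℕ 0ℓ} → Decidable P → ℕ → Set
HasSize {P} P? n = Σ ℕ λ N → (∀ l → P l → l < N) × (count P? N ≡ n)

Gap : (S : NumericalSemigroup) → Pred ℕ 0ℓ
Gap S l = ¬ (_∈Λ S l)

Gap? : (S : NumericalSemigroup) → Decidable (Gap S)
Gap? S l = ¬? (_∈Λ? S l)

IsGenus : NumericalSemigroup → ℕ → Set
IsGenus S g = HasSize (Gap? S) g

IsConductor : NumericalSemigroup → ℕ → Set
IsConductor S c =
  (∀ n → c ≤ n → _∈Λ S n) ×
  (∀ c′ → (∀ n → c′ ≤ n → _∈Λ S n) → c ≤ c′)

IsEnumeration : NumericalSemigroup → (ℕ → ℕ) → Set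
IsEnumeration S λ′ =
  (∀ i → _∈Λ S (λ′ i)) ×
  (∀ i j → i < j → λ′ i < λ′ j) ×
  (∀ x → _∈Λ S x → ∃ λ i → λ′ i ≡ x)

IsGenerator : NumericalSemigroup → ℕ → Set
IsGenerator S x =
  _∈Λ S x × x ≢ 0 ×
  ¬ (Σ ℕ λ a → Σ ℕ λ b → _∈Λ S a × _∈Λ S b × a ≢ 0 × b ≢ 0 × a + b ≡ x)

-- "m − l ∈ Λ" for the integer difference m − l (false when l > m)
DiffIn : NumericalSemigroup → ℕ → ℕ → Set
DiffIn S m l = l ≤ m × _∈Λ S (m ∸ l)

DiffIn? : (S : NumericalSemigroup) → (m l : ℕ) → Dec (DiffIn S m l)
DiffIn? S m l = (l ≤? m) ×-dec (_∈Λ? S (m ∸ l))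

D : (S : NumericalSemigroup) → (ℕ → ℕ) → ℕ → Pred ℕ 0ℓ
D S λ′ i l = Gap S l × ¬ DiffIn S (λ′ i) l

D? : (S : NumericalSemigroup) → (λ′ : ℕ → ℕ) → (i : ℕ) → Decidable (D S λ′ i)
D? S λ′ i l = Gap? S l ×-dec ¬? (DiffIn? S (λ′ i) l)

-- Fix m = λ_i ≥ c and split [0, m] according to whether l and m − l lie in Λ.
-- With A = #{l : l ∈ Λ, m − l ∈ Λ} and B = #{l : l ∉ Λ, m − l ∈ Λ}, the reflection
-- l ↦ m − l shows B = #{l : l ∈ Λ, m − l ∉ Λ}, so counting Λ ∩ [0, m] gives i + 1 = A + B,
-- and counting the gaps (all below c ≤ m) gives g = B + #D(i). Finally m is a generator
-- iff 0 and m are its only summands, i.e. A = 2, which is #D(i) = g − i + 1.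
module Submission where

open import Defs
open import Data.Nat using (ℕ; _≤_)
open import Data.Integer using (+_; _-_)
open import Relation.Binary.PropositionalEquality using (_≡_)
open import Function.Bundles using (_⇔_)

open import Data.Nat.Properties
import Data.Integer as ℤ
import Data.Integer.Properties as ℤ
open import Data.Integer.Solver using (module +-*-Solver)
open import Data.Product using (∃; _×_; _,_; proj₁; proj₂)
open import Data.Sum using (inj₁; inj₂)
open import Function using (_∘′_)
open import Function.Bundles using (mk⇔)
open import Function.Construct.Composition using (_⇔-∘_)
open import Function.Construct.Symmetry using (⇔-sym)
open import Level using (0ℓ)
open import Relation.Nullary using (¬_; yes; no; contradiction)
open import Relation.Binary.PropositionalEquality
  using (refl; sym; trans; cong; cong₂; subst; module ≡-Reasoning)
open import Relation.Unary using (Pred; Decidable)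
open import Relation.Unary.Properties using (_∩?_; ∁?)

open ≡-Reasoning

module Count where
  open import Data.Nat using (zero; suc; _+_; _∸_; _<_; z≤n)

  private variable
    P Q : Pred ℕ 0ℓ

  count-cong : (P? : Decidable P) (Q? : Decidable Q) → ∀ n →
    (∀ {l} → l < n → P l → Q l) → (∀ {l} → l < n → Q l → P l) →
    count P? n ≡ count Q? n
  count-cong P? Q? zero P⇒Q Q⇒P = refl
  count-cong P? Q? (suc n) P⇒Q Q⇒P with P? n | Q? n
  ... | yes p | yes q = cong suc (count-cong P? Q? n (P⇒Q ∘′ m<n⇒m<1+n) (Q⇒P ∘′ m<n⇒m<1+n))
  ... | yes p | no ¬q = contradiction (P⇒Q ≤-refl p) ¬q
  ... | no ¬p | yes q = contradiction (Q⇒P ≤-refl q) ¬p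
  ... | no ¬p | no ¬q = count-cong P? Q? n (P⇒Q ∘′ m<n⇒m<1+n) (Q⇒P ∘′ m<n⇒m<1+n)

  count-stable : (P? : Decidable P) → ∀ {m n} → m ≤ n → (∀ {l} → m ≤ l → l < n → ¬ P l) →
    count P? n ≡ count P? m
  count-stable P? {n = zero} z≤n none = refl
  count-stable P? {n = suc n} m≤1+n none with m≤n⇒m<n∨m≡n m≤1+n
  ... | inj₂ refl = refl
  ... | inj₁ m<1+n with P? n
  ...   | yes p = contradiction p (none (≤-pred m<1+n) ≤-refl)
  ...   | no _ = count-stable P? (≤-pred m<1+n) (λ m≤l l<n → none m≤l (m<n⇒m<1+n l<n))

  HasSize⇒count≡ : (P? : Decidable P) → ∀ {k n} → HasSize P? k → (∀ {l} → P l → l < n) →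
    count P? n ≡ k
  HasSize⇒count≡ P? {n = n} (N , P<N , count≡k) P<n with ≤-total N n
  ... | inj₁ N≤n = trans (count-stable P? N≤n (λ N≤l _ p → <⇒≱ (P<N _ p) N≤l)) count≡k
  ... | inj₂ n≤N = trans (sym (count-stable P? n≤N (λ n≤l _ p → <⇒≱ (P<n p) n≤l))) count≡k

  count≡0⇔ : (P? : Decidable P) → ∀ n → count P? n ≡ 0 ⇔ (∀ {l} → l < n → ¬ P l)
  count≡0⇔ {P} P? n = mk⇔ (to n) (λ none → count-stable P? z≤n (λ _ → none))
    where
    to : ∀ n → count P? n ≡ 0 → ∀ {l} → l < n → ¬ P l
    to (suc n) count≡0 l<1+n with P? n | m<1+n⇒m<n∨m≡n l<1+n
    ... | no _ | inj₁ l<n = to n count≡0 l<n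
    ... | no ¬p | inj₂ refl = ¬p

  count-1 : (P? : Decidable P) → P 0 → count P? 1 ≡ 1
  count-1 P? p with P? 0
  ... | yes _ = refl
  ... | no ¬p = contradiction p ¬p

  count-shift : (P? : Decidable P) → ∀ n →
    count P? (suc n) ≡ count (λ l → P? (suc l)) n + count P? 1
  count-shift P? zero = refl
  count-shift P? (suc n) with P? (suc n)
  ... | yes _ = cong suc (count-shift P? n)
  ... | no _ = count-shift P? n

  count-endpoints : (P? : Decidable P) → ∀ {k} → P 0 → P (suc k) →
    count P? (suc (suc k)) ≡ 2 + count (λ l → P? (suc l)) k
  count-endpoints P? {k} p₀ pₖ with P? (suc k)
  ... | no ¬pₖ = contradiction pₖ ¬pₖ
  ... | yes _ = cong suc (begin
    count P? (suc k)                            ≡⟨ count-shift P? k ⟩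
    count (λ l → P? (suc l)) k + count P? 1     ≡⟨ cong₂ _+_ refl (count-1 P? p₀) ⟩
    count (λ l → P? (suc l)) k + 1              ≡⟨ +-comm _ 1 ⟩
    1 + count (λ l → P? (suc l)) k              ∎)

  count-reflect : (P? : Decidable P) → ∀ n → count (λ l → P? (n ∸ l)) (suc n) ≡ count P? (suc n)
  count-reflect P? zero with P? 0
  ... | yes _ = refl
  ... | no _ = refl
  count-reflect P? (suc n) = begin
    count (λ l → P? (suc n ∸ l)) (suc (suc n))
      ≡⟨ count-shift (λ l → P? (suc n ∸ l)) (suc n) ⟩
    count (λ l → P? (n ∸ l)) (suc n) + count (λ l → P? (suc n ∸ l)) 1
      ≡⟨ cong (_+ count (λ l → P? (suc n ∸ l)) 1) (count-reflect P? n) ⟩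
    count P? (suc n) + count (λ l → P? (suc n ∸ l)) 1
      ≡⟨ add-top ⟩
    count P? (suc (suc n)) ∎
    where
    add-top : count P? (suc n) + count (λ l → P? (suc n ∸ l)) 1 ≡ count P? (suc (suc n))
    add-top with P? (suc n)
    ... | yes _ = +-comm _ 1
    ... | no _ = +-identityʳ _

  count-∩-∁ : (P? : Decidable P) (Q? : Decidable Q) → ∀ n →
    count P? n ≡ count (P? ∩? Q?) n + count (P? ∩? ∁? Q?) n
  count-∩-∁ P? Q? zero = refl
  count-∩-∁ P? Q? (suc n) with P? n | Q? n
  ... | yes _ | yes _ = cong suc (count-∩-∁ P? Q? n)
  ... | yes _ | no _ = trans (cong suc (count-∩-∁ P? Q? n)) (sym (+-suc _ _))
  ... | no _ | _ = count-∩-∁ P? Q? n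

module NumericalSemigroupCounting (S : NumericalSemigroup) where
  open import Data.Nat using (zero; suc; _+_; _∸_; _<_; z≤n; s≤s; z<s; _≤?_)
  open Count

  gap<conductor : ∀ {c l} → IsConductor S c → Gap S l → l < c
  gap<conductor {c} {l} (c-conductor , _) l∉Λ with c ≤? l
  ... | yes c≤l = contradiction (c-conductor l c≤l) l∉Λ
  ... | no c≰l = ≰⇒> c≰l

  count[∈Λ∩∁DiffIn]≡count[Gap∩DiffIn] : ∀ m →
    count (_∈Λ? S ∩? ∁? (DiffIn? S m)) (suc m) ≡ count (Gap? S ∩? DiffIn? S m) (suc m)
  count[∈Λ∩∁DiffIn]≡count[Gap∩DiffIn] m =
    trans (sym (count-reflect (_∈Λ? S ∩? ∁? (DiffIn? S m)) m))
          (count-cong (λ l → (_∈Λ? S ∩? ∁? (DiffIn? S m)) (m ∸ l)) (Gap? S ∩? DiffIn? S m)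
                      (suc m) to from)
    where
    to : ∀ {l} → l < suc m → _∈Λ S (m ∸ l) × ¬ DiffIn S m (m ∸ l) → Gap S l × DiffIn S m l
    to {l} l<1+m (m-l∈Λ , ¬m-[m-l]∈Λ) =
      (λ l∈Λ → ¬m-[m-l]∈Λ (m∸n≤m m l , subst (_∈Λ S) (sym (m∸[m∸n]≡n (≤-pred l<1+m))) l∈Λ)) ,
      (≤-pred l<1+m , m-l∈Λ)
    from : ∀ {l} → l < suc m → Gap S l × DiffIn S m l → _∈Λ S (m ∸ l) × ¬ DiffIn S m (m ∸ l)
    from l<1+m (l∉Λ , _ , m-l∈Λ) =
      m-l∈Λ , λ (_ , m-[m-l]∈Λ) → l∉Λ (subst (_∈Λ S) (m∸[m∸n]≡n (≤-pred l<1+m)) m-[m-l]∈Λ)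

  isGenerator⇔noInnerSummand : ∀ {k} → _∈Λ S (suc k) →
    IsGenerator S (suc k) ⇔ (∀ {j} → j < k → ¬ (_∈Λ S (suc j) × DiffIn S (suc k) (suc j)))
  isGenerator⇔noInnerSummand {k} m∈Λ = mk⇔ to from
    where
    to : IsGenerator S (suc k) → ∀ {j} → j < k → ¬ (_∈Λ S (suc j) × DiffIn S (suc k) (suc j))
    to (_ , _ , indecomposable) {j} j<k (j+1∈Λ , _ , k-j∈Λ) =
      indecomposable (suc j , k ∸ j , j+1∈Λ , k-j∈Λ , (λ ()) ,
                      n>0⇒n≢0 (m<n⇒0<n∸m j<k) , cong suc (m+[n∸m]≡n (<⇒≤ j<k)))
    from : (∀ {j} → j < k → ¬ (_∈Λ S (suc j) × DiffIn S (suc k) (suc j))) → IsGenerator S (suc k)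
    from noInner = m∈Λ , (λ ()) , λ where
      (zero , _ , _ , _ , a≢0 , _) → a≢0 refl
      (suc j , zero , _ , _ , _ , b≢0 , _) → b≢0 refl
      (suc j , suc b , a∈Λ , b∈Λ , _ , _ , a+b≡m) →
        let j+[1+b]≡k = suc-injective a+b≡m
            j<k = subst (j <_) j+[1+b]≡k (m<m+n j z<s)
            k-j≡1+b = trans (cong (_∸ j) (sym j+[1+b]≡k)) (m+n∸m≡n j (suc b))
        in noInner j<k (a∈Λ , s≤s (<⇒≤ j<k) , subst (_∈Λ S) (sym k-j≡1+b) b∈Λ)

  isGenerator⇔count[∈Λ∩DiffIn]≡2 : ∀ {m} → _∈Λ S m →
    IsGenerator S m ⇔ count (_∈Λ? S ∩? DiffIn? S m) (suc m) ≡ 2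
  isGenerator⇔count[∈Λ∩DiffIn]≡2 {zero} _ =
    mk⇔ (λ (_ , 0≢0 , _) → contradiction refl 0≢0)
        (λ count≡2 → contradiction (trans (sym count≡2) count≡1) λ ())
    where
    count≡1 : count (_∈Λ? S ∩? DiffIn? S 0) 1 ≡ 1
    count≡1 = count-1 (_∈Λ? S ∩? DiffIn? S 0) (zero∈ S , z≤n , zero∈ S)
  isGenerator⇔count[∈Λ∩DiffIn]≡2 {suc k} m∈Λ =
    mk⇔ (λ inner≡0 → trans endpoints (cong (_+_ 2) inner≡0))
        (λ count≡2 → +-cancelˡ-≡ 2 _ _ (trans (sym endpoints) count≡2))
      ⇔-∘ (⇔-sym (count≡0⇔ _ k) ⇔-∘ isGenerator⇔noInnerSummand m∈Λ)
    where
    m-m∈Λ : _∈Λ S (k ∸ k)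
    m-m∈Λ = subst (_∈Λ S) (sym (n∸n≡0 k)) (zero∈ S)
    endpoints : count (_∈Λ? S ∩? DiffIn? S (suc k)) (suc (suc k)) ≡
                2 + count (λ l → (_∈Λ? S ∩? DiffIn? S (suc k)) (suc l)) k
    endpoints = count-endpoints (_∈Λ? S ∩? DiffIn? S (suc k))
                                (zero∈ S , z≤n , m∈Λ) (m∈Λ , ≤-refl , m-m∈Λ)

  count[Gap∩DiffIn]+size≡genus : ∀ {g c m d} → IsGenus S g → IsConductor S c → c ≤ m →
    HasSize (Gap? S ∩? ∁? (DiffIn? S m)) d →
    count (Gap? S ∩? DiffIn? S m) (suc m) + d ≡ g
  count[Gap∩DiffIn]+size≡genus {g} {c} {m} {d} genus conductor c≤m size = begin
    count (Gap? S ∩? DiffIn? S m) (suc m) + d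
      ≡⟨ cong (_+_ _) (sym (HasSize⇒count≡ (Gap? S ∩? ∁? (DiffIn? S m)) size (gap<1+m ∘′ proj₁))) ⟩
    count (Gap? S ∩? DiffIn? S m) (suc m) + count (Gap? S ∩? ∁? (DiffIn? S m)) (suc m)
      ≡⟨ sym (count-∩-∁ (Gap? S) (DiffIn? S m) (suc m)) ⟩
    count (Gap? S) (suc m)
      ≡⟨ HasSize⇒count≡ (Gap? S) genus gap<1+m ⟩
    g ∎
    where
    gap<1+m : ∀ {l} → Gap S l → l < suc m
    gap<1+m l∉Λ = <-≤-trans (gap<conductor conductor l∉Λ) (m≤n⇒m≤1+n c≤m)

  module _ {enum : ℕ → ℕ} (E : IsEnumeration S enum) where
    private
      enum-∈Λ : ∀ i → _∈Λ S (enum i)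
      enum-∈Λ = proj₁ E
      enum-< : ∀ i j → i < j → enum i < enum j
      enum-< = proj₁ (proj₂ E)
      enum-onto : ∀ x → _∈Λ S x → ∃ λ i → enum i ≡ x
      enum-onto = proj₂ (proj₂ E)

    enum-mono-≤ : ∀ {i j} → i ≤ j → enum i ≤ enum j
    enum-mono-≤ i≤j with m≤n⇒m<n∨m≡n i≤j
    ... | inj₁ i<j = <⇒≤ (enum-< _ _ i<j)
    ... | inj₂ refl = ≤-refl

    enum-cancel-< : ∀ {i j} → enum i < enum j → i < j
    enum-cancel-< enum-i<enum-j = ≰⇒> λ j≤i → <⇒≱ enum-i<enum-j (enum-mono-≤ j≤i)

    enum-0≡0 : enum 0 ≡ 0
    enum-0≡0 with enum-onto 0 (zero∈ S)
    ... | j , enum-j≡0 = n≤0⇒n≡0 (subst (enum 0 ≤_) enum-j≡0 (enum-mono-≤ z≤n))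

    count[∈Λ]≡1+i : ∀ i → count (_∈Λ? S) (suc (enum i)) ≡ suc i
    count[∈Λ]≡1+i zero rewrite enum-0≡0 = count-1 (_∈Λ? S) (zero∈ S)
    count[∈Λ]≡1+i (suc k) with _∈Λ? S (enum (suc k))
    ... | no ∉Λ = contradiction (enum-∈Λ (suc k)) ∉Λ
    ... | yes _ =
      cong suc (trans (count-stable (_∈Λ? S) (enum-< k (suc k) (n<1+n k)) strictlyBetween)
                      (count[∈Λ]≡1+i k))
      where
      strictlyBetween : ∀ {l} → suc (enum k) ≤ l → l < enum (suc k) → ¬ _∈Λ S l
      strictlyBetween k<l l<k+1 l∈Λ with enum-onto _ l∈Λ
      ... | j , refl = <⇒≱ (enum-cancel-< k<l) (≤-pred (enum-cancel-< l<k+1))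

    count[∈Λ∩DiffIn]+count[Gap∩DiffIn]≡1+i : ∀ i →
      count (_∈Λ? S ∩? DiffIn? S (enum i)) (suc (enum i)) +
      count (Gap? S ∩? DiffIn? S (enum i)) (suc (enum i)) ≡ suc i
    count[∈Λ∩DiffIn]+count[Gap∩DiffIn]≡1+i i = begin
      count (_∈Λ? S ∩? DiffIn? S m) (suc m) + count (Gap? S ∩? DiffIn? S m) (suc m)
        ≡⟨ cong (_+_ _) (sym (count[∈Λ∩∁DiffIn]≡count[Gap∩DiffIn] m)) ⟩
      count (_∈Λ? S ∩? DiffIn? S m) (suc m) + count (_∈Λ? S ∩? ∁? (DiffIn? S m)) (suc m)
        ≡⟨ sym (count-∩-∁ (_∈Λ? S) (DiffIn? S m) (suc m)) ⟩
      count (_∈Λ? S) (suc m)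
        ≡⟨ count[∈Λ]≡1+i i ⟩
      suc i ∎
      where m = enum i

module Arithmetic where
  open import Data.Nat using (suc; _+_)
  open +-*-Solver using (solve; _:=_; _:+_; _:-_; con)

  A≡2⇔d+i≡g+1 : ∀ {A B d g i} → A + B ≡ suc i → B + d ≡ g → A ≡ 2 ⇔ d + i ≡ g + 1
  A≡2⇔d+i≡g+1 {A} {B} {d} {g} {i} A+B≡1+i B+d≡g = mk⇔
    (λ A≡2 → suc-injective (begin
      suc (d + i)  ≡⟨ 1+d+i≡A+g ⟩
      A + g        ≡⟨ cong (_+ g) A≡2 ⟩
      suc (1 + g)  ≡⟨ cong suc (+-comm 1 g) ⟩
      suc (g + 1)  ∎))
    (λ d+i≡g+1 → +-cancelʳ-≡ g A 2 (begin
      A + g        ≡⟨ sym 1+d+i≡A+g ⟩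
      suc (d + i)  ≡⟨ cong suc d+i≡g+1 ⟩
      suc (g + 1)  ≡⟨ cong suc (+-comm g 1) ⟩
      2 + g        ∎))
    where
    1+d+i≡A+g : suc (d + i) ≡ A + g
    1+d+i≡A+g = begin
      suc (d + i)  ≡⟨ sym (+-suc d i) ⟩
      d + suc i    ≡⟨ cong (_+_ d) (sym A+B≡1+i) ⟩
      d + (A + B)  ≡⟨ +-comm d (A + B) ⟩
      A + B + d    ≡⟨ +-assoc A B d ⟩
      A + (B + d)  ≡⟨ cong (_+_ A) B+d≡g ⟩
      A + g        ∎

  d+i≡g+1⇔+d≡+g-+i+1 : ∀ d g i → d + i ≡ g + 1 ⇔ + d ≡ (+ g - + i) ℤ.+ + 1
  d+i≡g+1⇔+d≡+g-+i+1 d g i = mk⇔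
    (λ d+i≡g+1 → begin
      + d                   ≡⟨ solve 2 (λ d i → d := (d :+ i) :- i) refl (+ d) (+ i) ⟩
      + (d + i) - + i       ≡⟨ cong (λ n → + n - + i) d+i≡g+1 ⟩
      + (g + 1) - + i
        ≡⟨ solve 2 (λ g i → (g :+ con (+ 1)) :- i := (g :- i) :+ con (+ 1)) refl (+ g) (+ i) ⟩
      (+ g - + i) ℤ.+ + 1   ∎)
    (λ +d≡+g-+i+1 → ℤ.+-injective (begin
      + d ℤ.+ + i                 ≡⟨ cong (ℤ._+ + i) +d≡+g-+i+1 ⟩
      (+ g - + i) ℤ.+ + 1 ℤ.+ + i
        ≡⟨ solve 2 (λ g i → (g :- i) :+ con (+ 1) :+ i := g :+ con (+ 1)) refl (+ g) (+ i) ⟩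
      + g ℤ.+ + 1                 ∎))

-- ℕ's _+_ is opened only inside the modules above: from here on _+_ is ℤ's, as in the theorem.
open import Data.Integer using (+_; _-_; _+_)
open NumericalSemigroupCounting
open Arithmetic

mainTheorem1 : (S : NumericalSemigroup) (enum : ℕ → ℕ) → IsEnumeration S enum →
    (g c : ℕ) → IsGenus S g → IsConductor S c →
    (i d : ℕ) → HasSize (D? S enum i) d →
    c ≤ enum i →
    (IsGenerator S (enum i) ⇔ (+ d ≡ (+ g - + i) + + 1))
-- D? S enum i unfolds to Gap? S ∩? ∁? (DiffIn? S (enum i)).
mainTheorem1 S enum E g c genus conductor i d D-size c≤λᵢ =
  d+i≡g+1⇔+d≡+g-+i+1 d g i
    ⇔-∘ (A≡2⇔d+i≡g+1 (count[∈Λ∩DiffIn]+count[Gap∩DiffIn]≡1+i S E i)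
                      (count[Gap∩DiffIn]+size≡genus S genus conductor c≤λᵢ D-size)
    ⇔-∘ isGenerator⇔count[∈Λ∩DiffIn]≡2 S (proj₁ E i))
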